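{- Let $m=6j-1$ be a prime, where $j$ is a positive integer. Then for every integer $n\geq 0$, $$p(n,3)\equiv 0 \pmod m \quad\Longleftrightarrow\quad n\equiv \varepsilon a \pmod{6m}\ \text{ for some } \varepsilon\in\{1,-1\} \text{ and } a\in\{0,1,2,2m-2,2m+1\}.$$
   Context: $p(n,3)$ denotes the number of partitions of the nonnegative integer $n$ into exactly three positive parts, i.e. the number of integer triples $(\lambda_1,\lambda_2,\lambda_3)$ with $\lambda_1\ge\lambda_2\ge\lambda_3>0$ and $\lambda_1+\lambda_2+\lambda_3=n$. -}

module Defs where

open import Data.Nat using (ℕ; _≤_; _≤?_; _+_)
open import Data.Nat.Properties using (_≟_)
open import Data.List using (List; length; filter; upTo; concatMap; map)
open import Data.Product using (_×_; _,_)
open import Relation.Binary.PropositionalEquality using (_≡_)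
open import Relation.Nullary.Decidable using (Dec; _×-dec_)

-- All triples (l1 , l2 , l3) with every entry in {0,…,n}
-- (every part of a partition of n lies in this range).
triples : ℕ → List (ℕ × ℕ × ℕ)
triples n =
  concatMap (λ a → concatMap (λ b → map (λ c → (a , b , c)) (upTo (n + 1)))
                             (upTo (n + 1)))
            (upTo (n + 1))

IsPartition3 : ℕ → ℕ × ℕ × ℕ → Set
IsPartition3 n (l1 , l2 , l3) = (l2 ≤ l1) × (l3 ≤ l2) × (1 ≤ l3) × (l1 + l2 + l3 ≡ n)

isPartition3? : (n : ℕ) → (t : ℕ × ℕ × ℕ) → Dec (IsPartition3 n t)
isPartition3? n (l1 , l2 , l3) =
  (l2 ≤? l1) ×-dec ((l3 ≤? l2) ×-dec ((1 ≤? l3) ×-dec (l1 + l2 + l3 ≟ n)))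

p3 : ℕ → ℕ
p3 n = length (filter (isPartition3? n) (triples n))

-- Removing 1 from every part of a partition of n + 3 into three parts leaves a partition
-- of n into at most three parts, so p(n+3,3) = p(n,3) + (⌊n/2⌋ + 1). Hence
-- p(n+6,3) = p(n,3) + n + 3, and p(6q+r,3) for r = 0,…,5 is 3q², q(3q+1), q(3q+2),
-- 3q(q+1)+1, (3q+1)(q+1), (3q+2)(q+1).
-- A prime m = 6j − 1 never divides 3q(q+1)+1: that would mean (q+1)³ ≡ q³ (mod m),
-- whereas cubing is a bijection modulo m, inverted by the power (2m−1)/3 by Fermat's
-- little theorem. In the other classes m divides one of the linear factors, which fixes
-- q modulo m and hence n modulo 6m. Conversely p(n+6mt,3) ≡ p(n,3) (mod m), so it is
-- enough to exhibit one n with m ∣ p(n,3) in each of the ten classes ±a.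

module Submission where

open import Defs
open import Data.Nat using (ℕ; _+_; _*_; _∸_; _≤_)
open import Data.Nat.Primality using (Prime)
open import Data.Nat.Divisibility using (_∣_)
open import Data.Integer using (ℤ; +_; -_) renaming (_-_ to _-ℤ_; _*_ to _*ℤ_)
open import Data.Integer.Divisibility using () renaming (_∣_ to _∣ℤ_)
open import Data.Product using (_×_; ∃-syntax)
open import Data.Sum using (_⊎_)
open import Relation.Binary.PropositionalEquality using (_≡_)
open import Function.Bundles using (_⇔_)

open import Data.Nat using (zero; suc; _^_; _<_; z≤n; s≤s; _≤?_)
open import Data.Nat.Properties
open import Data.Nat.Combinatorics using (_C_; nCn≡1; nC1≡n; k>n⇒nCk≡0; nCk+nC[k+1]≡[n+1]C[k+1])
open import Data.Nat.Divisibility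
  using (divides; _∣0; ∣⇒≤; ∣1⇒≡1; ∣-refl; ∣m∣n⇒∣m+n; ∣m+n∣m⇒∣n; ∣m⇒∣m*n; ∣n⇒∣m*n; m∣m*n; n∣m*n)
open import Data.Nat.DivMod using (_/_; _%_; m%n<n; m≡m%n+[m/n]*n)
open import Data.Nat.ListAction using (sum)
open import Data.Nat.ListAction.Properties using (sum-++)
open import Data.Nat.Primality using (euclidsLemma; ¬prime[1])
open import Data.Nat.Tactic.RingSolver using (solve-∀)
open import Data.Integer using (_⊖_) renaming (_+_ to _+ℤ_; ∣_∣ to ∣_∣ᶻ)
import Data.Integer.Properties as ℤ
open import Data.List using (List; []; _∷_; _++_; length; filter; upTo; applyUpTo; concatMap; map)
open import Data.List.Properties using (length-++; filter-++; map-upTo; applyUpTo-∷ʳ)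
open import Data.Product using (_,_; proj₁; proj₂)
open import Data.Sum using (inj₁; inj₂; [_,_]′)
open import Data.Empty using (⊥-elim)
open import Relation.Nullary using (Dec; yes; no; ¬_)
open import Relation.Nullary.Decidable using (_×-dec_)
open import Relation.Unary using (Decidable)
open import Relation.Binary.PropositionalEquality
open import Function.Base using (id; _∘_)
open import Function.Bundles using (mk⇔; Equivalence)
import Function.Properties.Equivalence as ⇔

𝟙 : {P : Set} → Dec P → ℕ
𝟙 (yes _) = 1
𝟙 (no _)  = 0

𝟙-⇔ : {P Q : Set} → P ⇔ Q → (p : Dec P) (q : Dec Q) → 𝟙 p ≡ 𝟙 q
𝟙-⇔ P⇔Q (yes _) (yes _) = refl
𝟙-⇔ P⇔Q (yes p) (no ¬q) = ⊥-elim (¬q (Equivalence.to P⇔Q p))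
𝟙-⇔ P⇔Q (no ¬p) (yes q) = ⊥-elim (¬p (Equivalence.from P⇔Q q))
𝟙-⇔ P⇔Q (no _)  (no _)  = refl

𝟙-no : {P : Set} → ¬ P → (p : Dec P) → 𝟙 p ≡ 0
𝟙-no ¬P (yes p) = ⊥-elim (¬P p)
𝟙-no ¬P (no _)  = refl

∑< : ℕ → (ℕ → ℕ) → ℕ
∑< N f = sum (applyUpTo f N)

syntax ∑< N (λ i → x) = ∑[ i < N ] x

∑-cong : ∀ N {f g : ℕ → ℕ} → (∀ i → f i ≡ g i) → ∑< N f ≡ ∑< N g
∑-cong zero    f≗g = refl
∑-cong (suc N) f≗g = cong₂ _+_ (f≗g 0) (∑-cong N (f≗g ∘ suc))

∑-zero : ∀ N {f : ℕ → ℕ} → (∀ i → f i ≡ 0) → ∑< N f ≡ 0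
∑-zero zero    f≗0 = refl
∑-zero (suc N) f≗0 = cong₂ _+_ (f≗0 0) (∑-zero N (f≗0 ∘ suc))

∑-tail : ∀ N (f : ℕ → ℕ) → f 0 ≡ 0 → ∑< (suc N) f ≡ ∑[ i < N ] f (suc i)
∑-tail N f f0≡0 = cong (_+ ∑< N (f ∘ suc)) f0≡0

∑-distrib-+ : ∀ N (f g : ℕ → ℕ) → ∑[ i < N ] (f i + g i) ≡ ∑< N f + ∑< N g
∑-distrib-+ zero    f g = refl
∑-distrib-+ (suc N) f g =
  trans (cong (λ z → f 0 + g 0 + z) (∑-distrib-+ N (f ∘ suc) (g ∘ suc)))
        (interchange (f 0) (g 0) (∑< N (f ∘ suc)) (∑< N (g ∘ suc)))
  where
  interchange : ∀ a b c d → (a + b) + (c + d) ≡ (a + c) + (b + d)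
  interchange = solve-∀

∑-last : ∀ N f → ∑< (suc N) f ≡ ∑< N f + f N
∑-last N f = begin
  sum (applyUpTo f (suc N))       ≡⟨ cong sum (applyUpTo-∷ʳ f N) ⟨
  sum (applyUpTo f N ++ f N ∷ []) ≡⟨ sum-++ (applyUpTo f N) (f N ∷ []) ⟩
  ∑< N f + (f N + 0)              ≡⟨ cong (λ z → ∑< N f + z) (+-identityʳ (f N)) ⟩
  ∑< N f + f N                    ∎
  where open ≡-Reasoning

*-distribˡ-∑ : ∀ N x f → x * ∑< N f ≡ ∑[ i < N ] (x * f i)
*-distribˡ-∑ zero    x f = *-zeroʳ x
*-distribˡ-∑ (suc N) x f =
  trans (*-distribˡ-+ x (f 0) (∑< N (f ∘ suc)))
        (cong (λ z → x * f 0 + z) (*-distribˡ-∑ N x (f ∘ suc)))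

∣-∑ : ∀ {d} N f → (∀ i → i < N → d ∣ f i) → d ∣ ∑< N f
∣-∑ {d} zero f d∣f = d ∣0
∣-∑ (suc N) f d∣f =
  ∣m∣n⇒∣m+n (d∣f 0 (s≤s z≤n)) (∣-∑ N (f ∘ suc) (λ i i<N → d∣f (suc i) (s≤s i<N)))

∑-𝟙-≟ : ∀ {k} N → k < N → ∑[ i < N ] 𝟙 (i ≟ k) ≡ 1
∑-𝟙-≟ {zero}  (suc N) _         = cong suc (∑-zero N λ i → 𝟙-no (λ ()) (suc i ≟ 0))
∑-𝟙-≟ {suc k} (suc N) (s≤s k<N) =
  trans (∑-cong N λ i → 𝟙-⇔ (mk⇔ suc-injective (cong suc)) (suc i ≟ suc k) (i ≟ k))
        (∑-𝟙-≟ N k<N)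

module _ {A : Set} {P : A → Set} (P? : Decidable P) where

  length-filter-map : ∀ {B : Set} (g : B → A) xs →
    length (filter P? (map g xs)) ≡ sum (map (𝟙 ∘ P? ∘ g) xs)
  length-filter-map g []       = refl
  length-filter-map g (x ∷ xs) with P? (g x)
  ... | yes _ = cong suc (length-filter-map g xs)
  ... | no  _ = length-filter-map g xs

  length-filter-concatMap : ∀ {B : Set} (F : B → List A) xs →
    length (filter P? (concatMap F xs)) ≡ sum (map (length ∘ filter P? ∘ F) xs)
  length-filter-concatMap F []       = refl
  length-filter-concatMap F (x ∷ xs) = begin
    length (filter P? (F x ++ concatMap F xs))
      ≡⟨ cong length (filter-++ P? (F x) (concatMap F xs)) ⟩
    length (filter P? (F x) ++ filter P? (concatMap F xs))
      ≡⟨ length-++ (filter P? (F x)) ⟩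
    length (filter P? (F x)) + length (filter P? (concatMap F xs))
      ≡⟨ cong (λ z → length (filter P? (F x)) + z) (length-filter-concatMap F xs) ⟩
    length (filter P? (F x)) + sum (map (length ∘ filter P? ∘ F) xs) ∎
    where open ≡-Reasoning

sum-map-upTo : ∀ f N → sum (map f (upTo N)) ≡ ∑< N f
sum-map-upTo f N = cong sum (map-upTo f N)

countPartitions3 : ℕ → ℕ → ℕ
countPartitions3 N n = ∑[ a < N ] ∑[ b < N ] ∑[ c < N ] 𝟙 (isPartition3? n (a , b , c))

p3≡countPartitions3 : ∀ n → p3 n ≡ countPartitions3 (n + 1) n
p3≡countPartitions3 n =
  trans (count-concatMap _) (∑-cong N λ a →
  trans (count-concatMap _) (∑-cong N λ b →
  trans (length-filter-map (isPartition3? n) _ (upTo N)) (sum-map-upTo _ N)))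
  where
  N = n + 1
  count-concatMap : (F : ℕ → List (ℕ × ℕ × ℕ)) →
    length (filter (isPartition3? n) (concatMap F (upTo N))) ≡
    ∑[ a < N ] length (filter (isPartition3? n) (F a))
  count-concatMap F =
    trans (length-filter-concatMap (isPartition3? n) F (upTo N)) (sum-map-upTo _ N)

IsPartition≤2 : ℕ → ℕ × ℕ → Set
IsPartition≤2 n (a , b) = b ≤ a × a + b ≡ n

isPartition≤2? : (n : ℕ) → (t : ℕ × ℕ) → Dec (IsPartition≤2 n t)
isPartition≤2? n (a , b) = (b ≤? a) ×-dec (a + b ≟ n)

countPartitions≤2 : ℕ → ℕ → ℕ
countPartitions≤2 N n = ∑[ a < N ] ∑[ b < N ] 𝟙 (isPartition≤2? n (a , b))

p≤2 : ℕ → ℕ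
p≤2 0             = 1
p≤2 1             = 1
p≤2 (suc (suc n)) = suc (p≤2 n)

p3′ : ℕ → ℕ
p3′ 0                   = 0
p3′ 1                   = 0
p3′ 2                   = 0
p3′ (suc (suc (suc n))) = p3′ n + p≤2 n

IsPartition≤2-suc-0 : ∀ {n a} → IsPartition≤2 (suc n) (suc a , 0) ⇔ a ≡ n
IsPartition≤2-suc-0 {n} {a} = mk⇔
  (λ (_ , e) → trans (sym (+-identityʳ a)) (suc-injective e))
  (λ { refl → z≤n , cong suc (+-identityʳ a) })

IsPartition≤2-suc-suc : ∀ {n a b} →
  IsPartition≤2 (2 + n) (suc a , suc b) ⇔ IsPartition≤2 n (a , b)
IsPartition≤2-suc-suc {n} {a} {b} = mk⇔
  (λ { (s≤s b≤a , e) → b≤a , suc-injective (trans (sym (+-suc a b)) (suc-injective e)) })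
  (λ (b≤a , e) → s≤s b≤a , cong suc (trans (+-suc a b) (cong suc e)))

countPartitions≤2-suc : ∀ N n → countPartitions≤2 (suc N) n ≡
  𝟙 (isPartition≤2? n (0 , 0)) +
    (∑[ a < N ] 𝟙 (isPartition≤2? n (suc a , 0)) +
     ∑[ a < N ] ∑[ b < N ] 𝟙 (isPartition≤2? n (suc a , suc b)))
countPartitions≤2-suc N n = cong₂ _+_
  (trans (cong (λ z → 𝟙 (isPartition≤2? n (0 , 0)) + z)
               (∑-zero N λ b → 𝟙-no (λ { (() , _) }) (isPartition≤2? n (0 , suc b))))
         (+-identityʳ _))
  (∑-distrib-+ N _ _)

∑-𝟙-isPartition≤2[1+a,0]≡1 : ∀ {n} N → n < N →
  ∑[ a < N ] 𝟙 (isPartition≤2? (suc n) (suc a , 0)) ≡ 1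
∑-𝟙-isPartition≤2[1+a,0]≡1 {n} N n<N =
  trans (∑-cong N λ a → 𝟙-⇔ IsPartition≤2-suc-0 _ (a ≟ n)) (∑-𝟙-≟ N n<N)

countPartitions≤2≡p≤2 : ∀ n N → n < N → countPartitions≤2 N n ≡ p≤2 n
countPartitions≤2≡p≤2 0 (suc N) _ = trans (countPartitions≤2-suc N 0) (cong suc (cong₂ _+_
  (∑-zero N λ a → 𝟙-no (λ { (_ , ()) }) (isPartition≤2? 0 (suc a , 0)))
  (∑-zero N λ a → ∑-zero N λ b → 𝟙-no (λ { (_ , ()) }) (isPartition≤2? 0 (suc a , suc b)))))
countPartitions≤2≡p≤2 1 (suc N) (s≤s 0<N) =
  trans (countPartitions≤2-suc N 1) (cong₂ _+_ (∑-𝟙-isPartition≤2[1+a,0]≡1 N 0<N)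
    (∑-zero N λ a → ∑-zero N λ b →
      𝟙-no (λ (_ , e) → 1+n≢0 (m+n≡0⇒n≡0 a (suc-injective e)))
           (isPartition≤2? 1 (suc a , suc b))))
countPartitions≤2≡p≤2 (suc (suc n)) (suc N) (s≤s n+1<N) =
  trans (countPartitions≤2-suc N (2 + n)) (cong₂ _+_ (∑-𝟙-isPartition≤2[1+a,0]≡1 N n+1<N)
    (trans (∑-cong N λ a → ∑-cong N λ b → 𝟙-⇔ IsPartition≤2-suc-suc _ _)
           (countPartitions≤2≡p≤2 n N (<-trans (n<1+n n) n+1<N))))

IsPartition3⇒positive : ∀ {n a b c} → IsPartition3 n (a , b , c) → 0 < a × 0 < b × 0 < c
IsPartition3⇒positive (b≤a , c≤b , 0<c , _) = ≤-trans 0<c (≤-trans c≤b b≤a) , ≤-trans 0<c c≤b , 0<c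

IsPartition3-suc-1 : ∀ {n a b} →
  IsPartition3 (3 + n) (suc a , suc b , 1) ⇔ IsPartition≤2 n (a , b)
IsPartition3-suc-1 {n} {a} {b} = mk⇔
  (λ { (s≤s b≤a , _ , _ , e) → b≤a , +-cancelˡ-≡ 3 _ _ (trans (sym (shift a b)) e) })
  (λ (b≤a , e) → s≤s b≤a , s≤s z≤n , s≤s z≤n , trans (shift a b) (cong (λ z → 3 + z) e))
  where
  shift : ∀ a b → suc a + suc b + 1 ≡ 3 + (a + b)
  shift = solve-∀

IsPartition3-suc-suc : ∀ {n a b c} →
  IsPartition3 (3 + n) (suc a , suc b , suc (suc c)) ⇔ IsPartition3 n (a , b , suc c)
IsPartition3-suc-suc {n} {a} {b} {c} = mk⇔
  (λ { (s≤s b≤a , s≤s c≤b , _ , e) →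
          b≤a , c≤b , s≤s z≤n , +-cancelˡ-≡ 3 _ _ (trans (sym (shift a b c)) e) })
  (λ (b≤a , c≤b , _ , e) →
     s≤s b≤a , s≤s c≤b , s≤s z≤n , trans (shift a b c) (cong (λ z → 3 + z) e))
  where
  shift : ∀ a b c → suc a + suc b + suc (suc c) ≡ 3 + (a + b + suc c)
  shift = solve-∀

𝟙-isPartition3[0,b,c]≡0 : ∀ n b c → 𝟙 (isPartition3? n (0 , b , c)) ≡ 0
𝟙-isPartition3[0,b,c]≡0 n b c =
  𝟙-no (n≮0 ∘ proj₁ ∘ IsPartition3⇒positive) (isPartition3? n (0 , b , c))

𝟙-isPartition3[a,0,c]≡0 : ∀ n a c → 𝟙 (isPartition3? n (a , 0 , c)) ≡ 0
𝟙-isPartition3[a,0,c]≡0 n a c =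
  𝟙-no (n≮0 ∘ proj₁ ∘ proj₂ ∘ IsPartition3⇒positive) (isPartition3? n (a , 0 , c))

𝟙-isPartition3[a,b,0]≡0 : ∀ n a b → 𝟙 (isPartition3? n (a , b , 0)) ≡ 0
𝟙-isPartition3[a,b,0]≡0 n a b =
  𝟙-no (n≮0 ∘ proj₂ ∘ proj₂ ∘ IsPartition3⇒positive) (isPartition3? n (a , b , 0))

countPartitions3-+3 : ∀ N n →
  countPartitions3 (2 + N) (3 + n) ≡ countPartitions≤2 (suc N) n + countPartitions3 (suc N) n
countPartitions3-+3 N n = begin
  ∑[ a < suc M ] ∑[ b < suc M ] ∑[ c < suc M ] I (3 + n) a b c
    ≡⟨ ∑-tail M (λ a → ∑[ b < suc M ] ∑[ c < suc M ] I (3 + n) a b c)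
         (∑-zero (suc M) λ b → ∑-zero (suc M) λ c → 𝟙-isPartition3[0,b,c]≡0 (3 + n) b c) ⟩
  ∑[ a < M ] ∑[ b < suc M ] ∑[ c < suc M ] I (3 + n) (suc a) b c
    ≡⟨ ∑-cong M (λ a → ∑-tail M (λ b → ∑[ c < suc M ] I (3 + n) (suc a) b c)
         (∑-zero (suc M) λ c → 𝟙-isPartition3[a,0,c]≡0 (3 + n) (suc a) c)) ⟩
  ∑[ a < M ] ∑[ b < M ] ∑[ c < suc M ] I (3 + n) (suc a) (suc b) c
    ≡⟨ ∑-cong M (λ a → ∑-cong M λ b → split-last-part a b) ⟩
  ∑[ a < M ] ∑[ b < M ] (K a b + ∑[ c < M ] I n a b c)
    ≡⟨ ∑-cong M (λ a → ∑-distrib-+ M (K a) (λ b → ∑[ c < M ] I n a b c)) ⟩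
  ∑[ a < M ] (∑[ b < M ] K a b + ∑[ b < M ] ∑[ c < M ] I n a b c)
    ≡⟨ ∑-distrib-+ M (λ a → ∑[ b < M ] K a b) (λ a → ∑[ b < M ] ∑[ c < M ] I n a b c) ⟩
  countPartitions≤2 M n + countPartitions3 M n ∎
  where
  open ≡-Reasoning
  M = suc N
  I : ℕ → ℕ → ℕ → ℕ → ℕ
  I n a b c = 𝟙 (isPartition3? n (a , b , c))
  K : ℕ → ℕ → ℕ
  K a b = 𝟙 (isPartition≤2? n (a , b))
  split-last-part : ∀ a b → ∑[ c < suc M ] I (3 + n) (suc a) (suc b) c ≡ K a b + ∑[ c < M ] I n a b c
  split-last-part a b = begin
    ∑[ c < suc M ] I (3 + n) (suc a) (suc b) c
      ≡⟨ ∑-tail M (I (3 + n) (suc a) (suc b)) (𝟙-isPartition3[a,b,0]≡0 (3 + n) (suc a) (suc b)) ⟩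
    I (3 + n) (suc a) (suc b) 1 + ∑[ c < N ] I (3 + n) (suc a) (suc b) (2 + c)
      ≡⟨ cong₂ _+_ (𝟙-⇔ IsPartition3-suc-1 _ _) (∑-cong N λ c → 𝟙-⇔ IsPartition3-suc-suc _ _) ⟩
    K a b + ∑[ c < N ] I n a b (suc c)
      ≡⟨ cong (λ z → K a b + z) (∑-tail N (I n a b) (𝟙-isPartition3[a,b,0]≡0 n a b)) ⟨
    K a b + ∑[ c < M ] I n a b c ∎

countPartitions3-<3 : ∀ N n → n < 3 → countPartitions3 N n ≡ 0
countPartitions3-<3 N n n<3 =
  ∑-zero N λ a → ∑-zero N λ b → ∑-zero N λ c → 𝟙-no too-small (isPartition3? n (a , b , c))
  where
  too-small : ∀ {a b c} → ¬ IsPartition3 n (a , b , c)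
  too-small p@(_ , _ , _ , e) with 0<a , 0<b , 0<c ← IsPartition3⇒positive p =
    <⇒≱ n<3 (subst (3 ≤_) e (+-mono-≤ (+-mono-≤ 0<a 0<b) 0<c))

countPartitions3≡p3′ : ∀ n N → n < N → countPartitions3 N n ≡ p3′ n
countPartitions3≡p3′ 0 N _ = countPartitions3-<3 N 0 (s≤s z≤n)
countPartitions3≡p3′ 1 N _ = countPartitions3-<3 N 1 (s≤s (s≤s z≤n))
countPartitions3≡p3′ 2 N _ = countPartitions3-<3 N 2 (s≤s (s≤s (s≤s z≤n)))
countPartitions3≡p3′ (suc (suc (suc n))) (suc (suc N)) (s≤s 3+n≤N+1) = begin
  countPartitions3 (2 + N) (3 + n)                       ≡⟨ countPartitions3-+3 N n ⟩
  countPartitions≤2 (suc N) n + countPartitions3 (suc N) n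
    ≡⟨ cong₂ _+_ (countPartitions≤2≡p≤2 n (suc N) n<N+1) (countPartitions3≡p3′ n (suc N) n<N+1) ⟩
  p≤2 n + p3′ n                                          ≡⟨ +-comm (p≤2 n) (p3′ n) ⟩
  p3′ (3 + n)                                            ∎
  where
  open ≡-Reasoning
  n<N+1 : n < suc N
  n<N+1 = ≤-trans (m≤n+m (suc n) 2) 3+n≤N+1

p3≡p3′ : ∀ n → p3 n ≡ p3′ n
p3≡p3′ n = trans (p3≡countPartitions3 n) (countPartitions3≡p3′ n (n + 1) (m<m+n n (s≤s z≤n)))

-- The quasi-polynomial p(n,3)

p≤2-+-p≤2-suc : ∀ n → p≤2 n + p≤2 (suc n) ≡ 2 + n
p≤2-+-p≤2-suc 0             = refl
p≤2-+-p≤2-suc 1             = refl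
p≤2-+-p≤2-suc (suc (suc n)) =
  cong suc (trans (+-suc (p≤2 n) (p≤2 (suc n))) (cong suc (p≤2-+-p≤2-suc n)))

p3′-+6 : ∀ n → p3′ (6 + n) ≡ p3′ n + (3 + n)
p3′-+6 n = begin
  p3′ n + p≤2 n + suc (p≤2 (suc n))   ≡⟨ +-assoc (p3′ n) (p≤2 n) _ ⟩
  p3′ n + (p≤2 n + suc (p≤2 (suc n))) ≡⟨ cong (λ z → p3′ n + z) (+-suc (p≤2 n) (p≤2 (suc n))) ⟩
  p3′ n + suc (p≤2 n + p≤2 (suc n))   ≡⟨ cong (λ x → p3′ n + suc x) (p≤2-+-p≤2-suc n) ⟩
  p3′ n + (3 + n)                     ∎
  where open ≡-Reasoning

p3′-+6k : ∀ k n → p3′ (k * 6 + n) + 3 * k ≡ p3′ n + k * (3 + n + 3 * k)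
p3′-+6k zero    n = refl
p3′-+6k (suc k) n = begin
  p3′ (6 + (k * 6 + n)) + 3 * suc k
    ≡⟨ cong (_+ 3 * suc k) (p3′-+6 (k * 6 + n)) ⟩
  p3′ (k * 6 + n) + (3 + (k * 6 + n)) + 3 * suc k
    ≡⟨ regroup (p3′ (k * 6 + n)) k n ⟩
  p3′ (k * 6 + n) + 3 * k + (6 + k * 6 + n)
    ≡⟨ cong (_+ (6 + k * 6 + n)) (p3′-+6k k n) ⟩
  p3′ n + k * (3 + n + 3 * k) + (6 + k * 6 + n)
    ≡⟨ complete-square (p3′ n) k n ⟩
  p3′ n + suc k * (3 + n + 3 * suc k) ∎
  where
  open ≡-Reasoning
  regroup : ∀ x k n → x + (3 + (k * 6 + n)) + 3 * suc k ≡ x + 3 * k + (6 + k * 6 + n)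
  regroup = solve-∀
  complete-square : ∀ x k n →
    x + k * (3 + n + 3 * k) + (6 + k * 6 + n) ≡ x + suc k * (3 + n + 3 * suc k)
  complete-square = solve-∀

p3′-closed-form : ∀ r (f : ℕ → ℕ) → (∀ q → p3′ r + q * (3 + r + 3 * q) ≡ f q + 3 * q) →
  ∀ q → p3′ (q * 6 + r) ≡ f q
p3′-closed-form r f eq q = +-cancelʳ-≡ (3 * q) _ _ (trans (p3′-+6k q r) (eq q))

p3′-6q+0 : ∀ q → p3′ (q * 6 + 0) ≡ 3 * (q * q)
p3′-6q+0 = p3′-closed-form 0 _ solve-∀

p3′-6q+1 : ∀ q → p3′ (q * 6 + 1) ≡ q * (3 * q + 1)
p3′-6q+1 = p3′-closed-form 1 _ solve-∀

p3′-6q+2 : ∀ q → p3′ (q * 6 + 2) ≡ q * (3 * q + 2)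
p3′-6q+2 = p3′-closed-form 2 _ solve-∀

p3′-6q+3 : ∀ q → p3′ (q * 6 + 3) ≡ 3 * q * (q + 1) + 1
p3′-6q+3 = p3′-closed-form 3 _ solve-∀

p3′-6q+4 : ∀ q → p3′ (q * 6 + 4) ≡ (3 * q + 1) * (q + 1)
p3′-6q+4 = p3′-closed-form 4 _ solve-∀

p3′-6q+5 : ∀ q → p3′ (q * 6 + 5) ≡ (3 * q + 2) * (q + 1)
p3′-6q+5 = p3′-closed-form 5 _ solve-∀

∣-transfer : ∀ {m a b c d} → a + b ≡ c + d → m ∣ b → m ∣ d → m ∣ a → m ∣ c
∣-transfer {m} {c = c} {d} a+b≡c+d m∣b m∣d m∣a =
  ∣m+n∣m⇒∣n (subst (m ∣_) (trans a+b≡c+d (+-comm c d)) (∣m∣n⇒∣m+n m∣a m∣b)) m∣d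

∣p3′-periodic : ∀ m t n → m ∣ p3′ (t * m * 6 + n) ⇔ m ∣ p3′ n
∣p3′-periodic m t n = mk⇔
  (∣-transfer (p3′-+6k k n) (∣n⇒∣m*n 3 m∣k) (∣m⇒∣m*n _ m∣k))
  (∣-transfer (sym (p3′-+6k k n)) (∣m⇒∣m*n _ m∣k) (∣n⇒∣m*n 3 m∣k))
  where
  k = t * m
  m∣k : m ∣ k
  m∣k = n∣m*n t

∣-product : ∀ {m n} x y → n ≡ x * y → m ∣ x ⊎ m ∣ y → m ∣ n
∣-product {m} x y n≡xy (inj₁ m∣x) = subst (m ∣_) (sym n≡xy) (∣m⇒∣m*n y m∣x)
∣-product {m} x y n≡xy (inj₂ m∣y) = subst (m ∣_) (sym n≡xy) (∣n⇒∣m*n x m∣y)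

-- Congruences carrying their quotient: n ≡⁺ a mod S is n ≡ a (mod S) with a ≤ n,
-- and n ≡⁻ a mod S is n ≡ −a (mod S).

infix 4 _≡⁺_mod_ _≡⁻_mod_

_≡⁺_mod_ : ℕ → ℕ → ℕ → Set
n ≡⁺ a mod S = ∃[ t ] n ≡ a + t * S

_≡⁻_mod_ : ℕ → ℕ → ℕ → Set
n ≡⁻ a mod S = ∃[ t ] n + a ≡ t * S

≡⁺-trans : ∀ {S a b c} → a ≡⁺ b mod S → b ≡⁺ c mod S → a ≡⁺ c mod S
≡⁺-trans {S} {c = c} (t , refl) (u , refl) = u + t , regroup c u t S
  where
  regroup : ∀ c u t S → c + u * S + t * S ≡ c + (u + t) * S
  regroup = solve-∀

≡⁺-^ : ∀ {S a b} e → a ≡⁺ b mod S → a ^ e ≡⁺ b ^ e mod S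
≡⁺-^             zero    _                = 0 , refl
≡⁺-^ {S} {b = b} (suc e) a≡⁺b@(t , refl) with u , aᵉ≡bᵉ+uS ← ≡⁺-^ e a≡⁺b =
  b * u + t * b ^ e + t * S * u , (begin
  (b + t * S) * (b + t * S) ^ e ≡⟨ cong ((b + t * S) *_) aᵉ≡bᵉ+uS ⟩
  (b + t * S) * (b ^ e + u * S) ≡⟨ expand b t S u (b ^ e) ⟩
  b * b ^ e + (b * u + t * b ^ e + t * S * u) * S ∎)
  where
  open ≡-Reasoning
  expand : ∀ b t S u y → (b + t * S) * (y + u * S) ≡ b * y + (b * u + t * y + t * S * u) * S
  expand = solve-∀

≡⁺-suc⇒∣1 : ∀ {S x a} → x ≡⁺ a mod S → x ≡⁺ suc a mod S → S ∣ 1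
≡⁺-suc⇒∣1 {S} {a = a} (t , x≡a+tS) (u , x≡1+a+uS) =
  ∣m+n∣m⇒∣n (divides t (trans (+-comm (u * S) 1) (sym tS≡1+uS))) (n∣m*n u)
  where
  tS≡1+uS : t * S ≡ 1 + u * S
  tS≡1+uS = +-cancelˡ-≡ a _ _ (trans (sym x≡a+tS) (trans x≡1+a+uS (sym (+-suc a (u * S)))))

∣⇒≡⁺0 : ∀ {m n} → m ∣ n → n ≡⁺ 0 mod m
∣⇒≡⁺0 (divides t n≡tm) = t , n≡tm

∣+⇒≡⁻ : ∀ {m n a} → m ∣ n + a → n ≡⁻ a mod m
∣+⇒≡⁻ (divides t n+a≡tm) = t , n+a≡tm

≡⁻⇒≡⁺ : ∀ {S n a b} → 0 < a → a + b ≡ S → n ≡⁻ a mod S → n ≡⁺ b mod S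
≡⁻⇒≡⁺ {n = n} 0<a _ (zero , n+a≡0) = ⊥-elim (<⇒≢ 0<a (sym (m+n≡0⇒n≡0 n n+a≡0)))
≡⁻⇒≡⁺ {S} {n} {a} {b} 0<a a+b≡S (suc t , n+a≡S+tS) = t , +-cancelʳ-≡ a _ _ (begin
  n + a           ≡⟨ n+a≡S+tS ⟩
  S + t * S       ≡⟨ cong (_+ t * S) a+b≡S ⟨
  a + b + t * S   ≡⟨ regroup a b (t * S) ⟩
  b + t * S + a   ∎)
  where
  open ≡-Reasoning
  regroup : ∀ a b x → a + b + x ≡ b + x + a
  regroup = solve-∀

≡⁺-scale : ∀ {m b c} Q r → Q ≡⁺ b mod m → b * 6 + r ≡ c → Q * 6 + r ≡⁺ c mod 6 * m
≡⁺-scale {m} {b} _ r (t , refl) refl = t , expand b t m r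
  where
  expand : ∀ b t m r → (b + t * m) * 6 + r ≡ b * 6 + r + t * (6 * m)
  expand = solve-∀

≡⁻-scale : ∀ {m b c} Q r → Q ≡⁻ b mod m → r + c ≡ b * 6 → Q * 6 + r ≡⁻ c mod 6 * m
≡⁻-scale {m} {b} {c} Q r (t , Q+b≡tm) r+c≡6b = t , (begin
  Q * 6 + r + c     ≡⟨ +-assoc (Q * 6) r c ⟩
  Q * 6 + (r + c)   ≡⟨ cong (λ z → Q * 6 + z) r+c≡6b ⟩
  Q * 6 + b * 6     ≡⟨ *-distribʳ-+ 6 Q b ⟨
  (Q + b) * 6       ≡⟨ cong (_* 6) Q+b≡tm ⟩
  t * m * 6         ≡⟨ reassociate t m ⟩
  t * (6 * m)       ∎)
  where
  open ≡-Reasoning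
  reassociate : ∀ t m → t * m * 6 ≡ t * (6 * m)
  reassociate = solve-∀

-- Fermat's little theorem and cube roots

[1+k]*[1+n]C[1+k]≡[1+n]*nCk : ∀ n k → suc k * (suc n C suc k) ≡ suc n * (n C k)
[1+k]*[1+n]C[1+k]≡[1+n]*nCk zero    zero    = refl
[1+k]*[1+n]C[1+k]≡[1+n]*nCk zero    (suc k) = *-zeroʳ (2 + k)
[1+k]*[1+n]C[1+k]≡[1+n]*nCk (suc n) zero    =
  trans (*-identityˡ ((2 + n) C 1)) (trans (nC1≡n (2 + n)) (sym (*-identityʳ (2 + n))))
[1+k]*[1+n]C[1+k]≡[1+n]*nCk (suc n) (suc k) = begin
  (2 + k) * ((2 + n) C (2 + k))
    ≡⟨ cong ((2 + k) *_) (nCk+nC[k+1]≡[n+1]C[k+1] (suc n) (suc k)) ⟨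
  (2 + k) * (X + Y)
    ≡⟨ split k X Y ⟩
  X + (suc k * X + (2 + k) * Y)
    ≡⟨ cong₂ (λ u v → X + (u + v))
             ([1+k]*[1+n]C[1+k]≡[1+n]*nCk n k) ([1+k]*[1+n]C[1+k]≡[1+n]*nCk n (suc k)) ⟩
  X + (suc n * (n C k) + suc n * (n C suc k))
    ≡⟨ cong (λ z → X + z) (*-distribˡ-+ (suc n) (n C k) (n C suc k)) ⟨
  X + suc n * (n C k + n C suc k)
    ≡⟨ cong (λ u → X + suc n * u) (nCk+nC[k+1]≡[n+1]C[k+1] n k) ⟩
  X + suc n * X ∎
  where
  open ≡-Reasoning
  X = suc n C suc k
  Y = suc n C (2 + k)
  split : ∀ k X Y → (2 + k) * (X + Y) ≡ X + (suc k * X + (2 + k) * Y)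
  split = solve-∀

prime∣pCk : ∀ {p k} → Prime p → 0 < k → k < p → p ∣ p C k
prime∣pCk {suc n} {suc k} p-prime _ k<p
  with euclidsLemma (suc k) (suc n C suc k) p-prime
         (divides (n C k) (trans ([1+k]*[1+n]C[1+k]≡[1+n]*nCk n k) (*-comm (suc n) (n C k))))
... | inj₁ p∣k   = ⊥-elim (<⇒≱ k<p (∣⇒≤ p∣k))
... | inj₂ p∣pCk = p∣pCk

binomial : ∀ x n → (1 + x) ^ n ≡ ∑[ k < suc n ] ((n C k) * x ^ k)
binomial x zero    = refl
binomial x (suc n) = sym (begin
  1 + ∑[ k < suc n ] ((suc n C suc k) * (x * x ^ k))
    ≡⟨ cong (λ z → 1 + z)
         (∑-cong (suc n) λ k → cong (_* (x * x ^ k)) (nCk+nC[k+1]≡[n+1]C[k+1] n k)) ⟨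
  1 + ∑[ k < suc n ] ((n C k + n C suc k) * (x * x ^ k))
    ≡⟨ cong (λ z → 1 + z) (∑-cong (suc n) λ k → distribute (n C k) (n C suc k) x (x ^ k)) ⟩
  1 + ∑[ k < suc n ] (x * ((n C k) * x ^ k) + (n C suc k) * x ^ suc k)
    ≡⟨ cong (λ z → 1 + z)
         (∑-distrib-+ (suc n) (λ k → x * ((n C k) * x ^ k)) (λ k → (n C suc k) * x ^ suc k)) ⟩
  1 + (∑[ k < suc n ] (x * ((n C k) * x ^ k)) + ∑[ k < suc n ] ((n C suc k) * x ^ suc k))
    ≡⟨ cong₂ (λ u v → 1 + (u + v))
             (*-distribˡ-∑ (suc n) x (λ k → (n C k) * x ^ k)) (sym drop-top) ⟨
  1 + (x * (1 + G) + G)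
    ≡⟨ factor x G ⟩
  (1 + x) * (1 + G)
    ≡⟨ cong ((1 + x) *_) (binomial x n) ⟨
  (1 + x) * (1 + x) ^ n ∎)
  where
  open ≡-Reasoning
  G = ∑[ k < n ] ((n C suc k) * x ^ suc k)
  drop-top : ∑[ k < suc n ] ((n C suc k) * x ^ suc k) ≡ G
  drop-top = begin
    ∑[ k < suc n ] ((n C suc k) * x ^ suc k) ≡⟨ ∑-last n (λ k → (n C suc k) * x ^ suc k) ⟩
    G + (n C suc n) * x ^ suc n              ≡⟨ cong (λ c → G + c * x ^ suc n) (k>n⇒nCk≡0 (n<1+n n)) ⟩
    G + 0                                    ≡⟨ +-identityʳ G ⟩
    G                                        ∎
  distribute : ∀ a b x y → (a + b) * (x * y) ≡ x * (a * y) + b * (x * y)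
  distribute = solve-∀
  factor : ∀ x g → 1 + (x * (1 + g) + g) ≡ (1 + x) * (1 + g)
  factor = solve-∀

[1+x]^p≡⁺1+x^p : ∀ {p} → Prime p → ∀ x → (1 + x) ^ p ≡⁺ 1 + x ^ p mod p
[1+x]^p≡⁺1+x^p {suc n} p-prime x
  with divides t middle≡tp ← ∣-∑ n (λ k → (suc n C suc k) * x ^ suc k)
         (λ k k<n → ∣m⇒∣m*n (x ^ suc k) (prime∣pCk p-prime (s≤s z≤n) (s≤s k<n))) =
  t , (begin
  (1 + x) ^ suc n
    ≡⟨ binomial x (suc n) ⟩
  1 + ∑[ k < suc n ] ((suc n C suc k) * x ^ suc k)
    ≡⟨ cong (λ z → 1 + z) (∑-last n (λ k → (suc n C suc k) * x ^ suc k)) ⟩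
  1 + (∑[ k < n ] ((suc n C suc k) * x ^ suc k) + (suc n C suc n) * x ^ suc n)
    ≡⟨ cong₂ (λ u c → 1 + (u + c * x ^ suc n)) middle≡tp (nCn≡1 (suc n)) ⟩
  1 + (t * suc n + 1 * x ^ suc n)
    ≡⟨ regroup (x ^ suc n) (t * suc n) ⟩
  1 + x ^ suc n + t * suc n ∎)
  where
  open ≡-Reasoning
  regroup : ∀ y z → 1 + (z + 1 * y) ≡ 1 + y + z
  regroup = solve-∀

fermat : ∀ {p} → Prime p → ∀ x → x ^ p ≡⁺ x mod p
fermat {suc n} p-prime zero    = 0 , refl
fermat {p}     p-prime (suc x) with t , xᵖ≡x+tp ← fermat p-prime x =
  ≡⁺-trans ([1+x]^p≡⁺1+x^p p-prime x) (t , cong suc xᵖ≡x+tp)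

[x^3]^E≡⁺x : ∀ {p E} → Prime p → 3 * E + 1 ≡ 2 * p → ∀ x → (x ^ 3) ^ E ≡⁺ x mod p
[x^3]^E≡⁺x {suc k} {E} p-prime 3E+1≡2p x with t , xᵖ≡x+tp ← fermat p-prime x =
  ≡⁺-trans (t * x ^ k , (begin
  (x ^ 3) ^ E               ≡⟨ ^-*-assoc x 3 E ⟩
  x ^ (3 * E)               ≡⟨ cong (x ^_) 3E≡p+k ⟩
  x ^ (suc k + k)           ≡⟨ ^-distribˡ-+-* x (suc k) k ⟩
  x ^ suc k * x ^ k         ≡⟨ cong (_* x ^ k) xᵖ≡x+tp ⟩
  (x + t * suc k) * x ^ k   ≡⟨ expand x t (suc k) (x ^ k) ⟩
  x * x ^ k + t * x ^ k * suc k ∎)) (fermat p-prime x)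
  where
  open ≡-Reasoning
  3E≡p+k : 3 * E ≡ suc k + k
  3E≡p+k = +-cancelʳ-≡ 1 _ _ (trans 3E+1≡2p (double k))
    where
    double : ∀ k → 2 * suc k ≡ suc k + k + 1
    double = solve-∀
  expand : ∀ x t p y → (x + t * p) * y ≡ x * y + t * y * p
  expand = solve-∀

prime∤3q[q+1]+1 : ∀ {p E} → Prime p → 3 * E + 1 ≡ 2 * p → ∀ q → ¬ p ∣ 3 * q * (q + 1) + 1
prime∤3q[q+1]+1 {p} {E} p-prime 3E+1≡2p q (divides c eq) =
  ¬prime[1] (subst Prime (∣1⇒≡1 p∣1) p-prime)
  where
  cube : ∀ q → (1 + q) * ((1 + q) * ((1 + q) * 1)) ≡ q * (q * (q * 1)) + (3 * q * (q + 1) + 1)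
  cube = solve-∀
  [1+q]³≡⁺q³ : (1 + q) ^ 3 ≡⁺ q ^ 3 mod p
  [1+q]³≡⁺q³ = c , trans (cube q) (cong (λ z → q ^ 3 + z) eq)
  p∣1 : p ∣ 1
  p∣1 = ≡⁺-suc⇒∣1 (≡⁺-trans (≡⁺-^ E [1+q]³≡⁺q³) ([x^3]^E≡⁺x {E = E} p-prime 3E+1≡2p q))
                  ([x^3]^E≡⁺x {E = E} p-prime 3E+1≡2p (1 + q))

∣[+n]-[+1*+a]∣≡∣n⊖a∣ : ∀ n a → ∣ (+ n) -ℤ (+ 1 *ℤ + a) ∣ᶻ ≡ ∣ n ⊖ a ∣ᶻ
∣[+n]-[+1*+a]∣≡∣n⊖a∣ n a =
  cong ∣_∣ᶻ (trans (cong ((+ n) -ℤ_) (ℤ.*-identityˡ (+ a))) (ℤ.[+m]-[+n]≡m⊖n n a))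

∣[+n]-[-1*+a]∣≡n+a : ∀ n a → ∣ (+ n) -ℤ (- (+ 1) *ℤ + a) ∣ᶻ ≡ n + a
∣[+n]-[-1*+a]∣≡n+a n a =
  trans (cong (λ x → ∣ (+ n) -ℤ x ∣ᶻ) (ℤ.-1*i≡-i (+ a)))
        (cong (λ x → ∣ (+ n) +ℤ x ∣ᶻ) (ℤ.neg-involutive (+ a)))

∣ℤ⇔≡⁻ : ∀ {S n a} → (+ S ∣ℤ (+ n) -ℤ (- (+ 1) *ℤ + a)) ⇔ n ≡⁻ a mod S
∣ℤ⇔≡⁻ {S} {n} {a} = mk⇔
  (λ (divides t e) → t , trans (sym (∣[+n]-[-1*+a]∣≡n+a n a)) e)
  (λ (t , e) → divides t (trans (∣[+n]-[-1*+a]∣≡n+a n a) e))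

∣n⊖a∣≡tS⇒n≡a+tS : ∀ {S n a} t → a < S → ∣ n ⊖ a ∣ᶻ ≡ t * S → n ≡ a + t * S
∣n⊖a∣≡tS⇒n≡a+tS {S} {n} {a} t a<S ∣n⊖a∣≡tS with ≤-<-connex a n
... | inj₁ a≤n = begin
  n             ≡⟨ m+[n∸m]≡n a≤n ⟨
  a + (n ∸ a)   ≡⟨ cong (λ x → a + ∣ x ∣ᶻ) (ℤ.⊖-≥ a≤n) ⟨
  a + ∣ n ⊖ a ∣ᶻ ≡⟨ cong (λ x → a + x) ∣n⊖a∣≡tS ⟩
  a + t * S     ∎
  where open ≡-Reasoning
... | inj₂ n<a = ⊥-elim (≢-multiple t (trans (sym (ℤ.∣⊖∣-< n<a)) ∣n⊖a∣≡tS))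
  where
  ≢-multiple : ∀ t → a ∸ n ≢ t * S
  ≢-multiple zero    a∸n≡0    = <⇒≱ n<a (m∸n≡0⇒m≤n a∸n≡0)
  ≢-multiple (suc t) a∸n≡S+tS =
    <⇒≱ a<S (≤-trans (subst (S ≤_) (sym a∸n≡S+tS) (m≤m+n S (t * S))) (m∸n≤m a n))

∣ℤ⇔≡⁺ : ∀ {S n a} → a < S → (+ S ∣ℤ (+ n) -ℤ (+ 1 *ℤ + a)) ⇔ n ≡⁺ a mod S
∣ℤ⇔≡⁺ {S} {n} {a} a<S = mk⇔
  (λ (divides t e) → t , ∣n⊖a∣≡tS⇒n≡a+tS t a<S (trans (sym (∣[+n]-[+1*+a]∣≡∣n⊖a∣ n a)) e))
  (λ { (t , refl) → divides t (begin
    ∣ + (a + t * S) -ℤ (+ 1 *ℤ + a) ∣ᶻ ≡⟨ ∣[+n]-[+1*+a]∣≡∣n⊖a∣ (a + t * S) a ⟩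
    ∣ (a + t * S) ⊖ a ∣ᶻ              ≡⟨ cong ∣_∣ᶻ (ℤ.⊖-≥ (m≤m+n a (t * S))) ⟩
    a + t * S ∸ a                    ≡⟨ m+n∸m≡n a (t * S) ⟩
    t * S                            ∎) })
  where open ≡-Reasoning

≡±⇔∣ℤ : ∀ {S n} (A : ℕ → Set) → (∀ {a} → A a → a < S) →
  (∃[ a ] (A a × (n ≡⁺ a mod S ⊎ n ≡⁻ a mod S))) ⇔
  (∃[ ε ] ∃[ a ] ((ε ≡ + 1 ⊎ ε ≡ - (+ 1)) × A a × (+ S ∣ℤ (+ n) -ℤ (ε *ℤ + a))))
≡±⇔∣ℤ {S} {n} A A⇒<S = mk⇔
  (λ { (a , Aa , inj₁ n≡⁺a) →
          + 1 , a , inj₁ refl , Aa , Equivalence.from (∣ℤ⇔≡⁺ {S} {n} (A⇒<S Aa)) n≡⁺a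
      ; (a , Aa , inj₂ n≡⁻a) →
          - (+ 1) , a , inj₂ refl , Aa , Equivalence.from (∣ℤ⇔≡⁻ {S} {n} {a}) n≡⁻a })
  (λ { (_ , a , inj₁ refl , Aa , S∣n-a) →
          a , Aa , inj₁ (Equivalence.to (∣ℤ⇔≡⁺ {S} {n} (A⇒<S Aa)) S∣n-a)
      ; (_ , a , inj₂ refl , Aa , S∣n+a) →
          a , Aa , inj₂ (Equivalence.to (∣ℤ⇔≡⁻ {S} {n} {a}) S∣n+a) })

Exceptional : ℕ → ℕ → Set
Exceptional m a = a ≡ 0 ⊎ a ≡ 1 ⊎ a ≡ 2 ⊎ a ≡ 2 * m ∸ 2 ⊎ a ≡ 2 * m + 1

≡±Exceptional : ℕ → ℕ → Set
≡±Exceptional m n = ∃[ a ] (Exceptional m a × (n ≡⁺ a mod 6 * m ⊎ n ≡⁻ a mod 6 * m))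

-- The prime 6j − 1 is written 5 + 6i, so that its arithmetic is polynomial in i.
module Residues {i : ℕ} (m-prime : Prime (5 + 6 * i)) where

  m : ℕ
  m = 5 + 6 * i

  2m∸2≡[1+2i]*6+2 : 2 * m ∸ 2 ≡ (1 + 2 * i) * 6 + 2
  2m∸2≡[1+2i]*6+2 = cong (_∸ 2) (identity i)
    where
    identity : ∀ i → 2 * (5 + 6 * i) ≡ 2 + ((1 + 2 * i) * 6 + 2)
    identity = solve-∀

  2m+1≡[1+2i]*6+5 : 2 * m + 1 ≡ (1 + 2 * i) * 6 + 5
  2m+1≡[1+2i]*6+5 = identity i
    where
    identity : ∀ i → 2 * (5 + 6 * i) + 1 ≡ (1 + 2 * i) * 6 + 5
    identity = solve-∀

  3[3+4i]+1≡2m : 3 * (3 + 4 * i) + 1 ≡ 2 * m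
  3[3+4i]+1≡2m = identity i
    where
    identity : ∀ i → 3 * (3 + 4 * i) + 1 ≡ 2 * (5 + 6 * i)
    identity = solve-∀

  m∣3[1+2i]+2 : m ∣ 3 * (1 + 2 * i) + 2
  m∣3[1+2i]+2 = divides 1 (identity i)
    where
    identity : ∀ i → 3 * (1 + 2 * i) + 2 ≡ 1 * (5 + 6 * i)
    identity = solve-∀

  m∣[4+6i]+1 : m ∣ 4 + 6 * i + 1
  m∣[4+6i]+1 = divides 1 (identity i)
    where
    identity : ∀ i → 4 + 6 * i + 1 ≡ 1 * (5 + 6 * i)
    identity = solve-∀

  ∣3*⇒∣ : ∀ {x} → m ∣ 3 * x → m ∣ x
  ∣3*⇒∣ {x} m∣3x with euclidsLemma 3 x m-prime m∣3x
  ... | inj₁ m∣3 = ⊥-elim (<⇒≱ (s≤s (s≤s (s≤s (s≤s z≤n)))) (∣⇒≤ m∣3))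
  ... | inj₂ m∣x = m∣x

  ∣3q+1⇒≡⁻ : ∀ q → m ∣ 3 * q + 1 → q ≡⁻ 2 + 2 * i mod m
  ∣3q+1⇒≡⁻ q m∣3q+1 =
    ∣+⇒≡⁻ {n = q} (∣3*⇒∣ (subst (m ∣_) (add-m q i) (∣m∣n⇒∣m+n m∣3q+1 (∣-refl {m}))))
    where
    add-m : ∀ q i → 3 * q + 1 + (5 + 6 * i) ≡ 3 * (q + (2 + 2 * i))
    add-m = solve-∀

  ∣3q+2⇒≡⁺ : ∀ q → m ∣ 3 * q + 2 → q ≡⁺ 1 + 2 * i mod m
  ∣3q+2⇒≡⁺ q m∣3q+2 = ≡⁻⇒≡⁺ {a = 4 + 4 * i} (s≤s z≤n) (split i)
    (∣+⇒≡⁻ {n = q} (∣3*⇒∣ (subst (m ∣_) (add-2m q i) (∣m∣n⇒∣m+n m∣3q+2 (m∣m*n 2)))))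
    where
    add-2m : ∀ q i → 3 * q + 2 + (5 + 6 * i) * 2 ≡ 3 * (q + (4 + 4 * i))
    add-2m = solve-∀
    split : ∀ i → 4 + 4 * i + (1 + 2 * i) ≡ 5 + 6 * i
    split = solve-∀

  ∣p3′[6q+r]⇒≡±Exceptional : ∀ q r → r < 6 → m ∣ p3′ (q * 6 + r) → ≡±Exceptional m (q * 6 + r)
  ∣p3′[6q+r]⇒≡±Exceptional q 0 _ m∣p
    with m∣q ← [ id , id ]′ (euclidsLemma q q m-prime (∣3*⇒∣ (subst (m ∣_) (p3′-6q+0 q) m∣p))) =
    0 , inj₁ refl , inj₁ (≡⁺-scale q 0 (∣⇒≡⁺0 {n = q} m∣q) refl)
  ∣p3′[6q+r]⇒≡±Exceptional q 1 _ m∣p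
    with euclidsLemma q (3 * q + 1) m-prime (subst (m ∣_) (p3′-6q+1 q) m∣p)
  ... | inj₁ m∣q    = 1 , inj₂ (inj₁ refl) , inj₁ (≡⁺-scale q 1 (∣⇒≡⁺0 {n = q} m∣q) refl)
  ... | inj₂ m∣3q+1 = 2 * m + 1 , inj₂ (inj₂ (inj₂ (inj₂ refl))) ,
                      inj₂ (≡⁻-scale q 1 (∣3q+1⇒≡⁻ q m∣3q+1) (total i))
    where
    total : ∀ i → 1 + (2 * (5 + 6 * i) + 1) ≡ (2 + 2 * i) * 6
    total = solve-∀
  ∣p3′[6q+r]⇒≡±Exceptional q 2 _ m∣p
    with euclidsLemma q (3 * q + 2) m-prime (subst (m ∣_) (p3′-6q+2 q) m∣p)
  ... | inj₁ m∣q    = 2 , inj₂ (inj₂ (inj₁ refl)) , inj₁ (≡⁺-scale q 2 (∣⇒≡⁺0 {n = q} m∣q) refl)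
  ... | inj₂ m∣3q+2 = 2 * m ∸ 2 , inj₂ (inj₂ (inj₂ (inj₁ refl))) ,
                      inj₁ (≡⁺-scale q 2 (∣3q+2⇒≡⁺ q m∣3q+2) (sym 2m∸2≡[1+2i]*6+2))
  ∣p3′[6q+r]⇒≡±Exceptional q 3 _ m∣p =
    ⊥-elim (prime∤3q[q+1]+1 {E = 3 + 4 * i} m-prime 3[3+4i]+1≡2m q
              (subst (m ∣_) (p3′-6q+3 q) m∣p))
  ∣p3′[6q+r]⇒≡±Exceptional q 4 _ m∣p
    with euclidsLemma (3 * q + 1) (q + 1) m-prime (subst (m ∣_) (p3′-6q+4 q) m∣p)
  ... | inj₁ m∣3q+1 = 2 * m ∸ 2 , inj₂ (inj₂ (inj₂ (inj₁ refl))) ,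
                      inj₂ (≡⁻-scale q 4 (∣3q+1⇒≡⁻ q m∣3q+1)
                              (trans (cong (λ z → 4 + z) 2m∸2≡[1+2i]*6+2) (total i)))
    where
    total : ∀ i → 4 + ((1 + 2 * i) * 6 + 2) ≡ (2 + 2 * i) * 6
    total = solve-∀
  ... | inj₂ m∣q+1  = 2 , inj₂ (inj₂ (inj₁ refl)) , inj₂ (≡⁻-scale q 4 (∣+⇒≡⁻ {n = q} m∣q+1) refl)
  ∣p3′[6q+r]⇒≡±Exceptional q 5 _ m∣p
    with euclidsLemma (3 * q + 2) (q + 1) m-prime (subst (m ∣_) (p3′-6q+5 q) m∣p)
  ... | inj₁ m∣3q+2 = 2 * m + 1 , inj₂ (inj₂ (inj₂ (inj₂ refl))) ,
                      inj₁ (≡⁺-scale q 5 (∣3q+2⇒≡⁺ q m∣3q+2) (sym 2m+1≡[1+2i]*6+5))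
  ... | inj₂ m∣q+1  = 1 , inj₂ (inj₁ refl) , inj₂ (≡⁻-scale q 5 (∣+⇒≡⁻ {n = q} m∣q+1) refl)
  ∣p3′[6q+r]⇒≡±Exceptional q (suc (suc (suc (suc (suc (suc _))))))
    (s≤s (s≤s (s≤s (s≤s (s≤s (s≤s ())))))) _

  exceptional-partner : ∀ {a} → Exceptional m a → m ∣ p3′ a × ∃[ b ] (a + b ≡ 6 * m × m ∣ p3′ b)
  exceptional-partner (inj₁ refl) =
    m ∣0 , m * 6 + 0 , trans (+-identityʳ (m * 6)) (*-comm m 6) ,
    ∣-product 3 (m * m) (p3′-6q+0 m) (inj₂ (m∣m*n m))
  exceptional-partner (inj₂ (inj₁ refl)) =
    m ∣0 , Q * 6 + 5 , total i , ∣-product (3 * Q + 2) (Q + 1) (p3′-6q+5 Q) (inj₂ m∣[4+6i]+1)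
    where
    Q = 4 + 6 * i
    total : ∀ i → 1 + ((4 + 6 * i) * 6 + 5) ≡ 6 * (5 + 6 * i)
    total = solve-∀
  exceptional-partner (inj₂ (inj₂ (inj₁ refl))) =
    m ∣0 , Q * 6 + 4 , total i , ∣-product (3 * Q + 1) (Q + 1) (p3′-6q+4 Q) (inj₂ m∣[4+6i]+1)
    where
    Q = 4 + 6 * i
    total : ∀ i → 2 + ((4 + 6 * i) * 6 + 4) ≡ 6 * (5 + 6 * i)
    total = solve-∀
  exceptional-partner (inj₂ (inj₂ (inj₂ (inj₁ refl)))) =
    subst (λ x → m ∣ p3′ x) (sym 2m∸2≡[1+2i]*6+2)
      (∣-product Q (3 * Q + 2) (p3′-6q+2 Q) (inj₂ m∣3[1+2i]+2)) ,
    Q′ * 6 + 4 , trans (cong (_+ (Q′ * 6 + 4)) 2m∸2≡[1+2i]*6+2) (total i) ,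
    ∣-product (3 * Q′ + 1) (Q′ + 1) (p3′-6q+4 Q′) (inj₁ (divides 2 3[3+4i]+1≡2m))
    where
    Q  = 1 + 2 * i
    Q′ = 3 + 4 * i
    total : ∀ i → (1 + 2 * i) * 6 + 2 + ((3 + 4 * i) * 6 + 4) ≡ 6 * (5 + 6 * i)
    total = solve-∀
  exceptional-partner (inj₂ (inj₂ (inj₂ (inj₂ refl)))) =
    subst (λ x → m ∣ p3′ x) (sym 2m+1≡[1+2i]*6+5)
      (∣-product (3 * Q + 2) (Q + 1) (p3′-6q+5 Q) (inj₁ m∣3[1+2i]+2)) ,
    Q′ * 6 + 1 , total i ,
    ∣-product Q′ (3 * Q′ + 1) (p3′-6q+1 Q′) (inj₂ (divides 2 3[3+4i]+1≡2m))
    where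
    Q  = 1 + 2 * i
    Q′ = 3 + 4 * i
    total : ∀ i → 2 * (5 + 6 * i) + 1 + ((3 + 4 * i) * 6 + 1) ≡ 6 * (5 + 6 * i)
    total = solve-∀

  ≡±Exceptional⇒∣p3′ : ∀ n → ≡±Exceptional m n → m ∣ p3′ n
  ≡±Exceptional⇒∣p3′ n (a , exceptional , inj₁ (t , refl)) =
    subst (λ x → m ∣ p3′ x) (reorder t m a)
      (Equivalence.from (∣p3′-periodic m t a) (proj₁ (exceptional-partner exceptional)))
    where
    reorder : ∀ t m a → t * m * 6 + a ≡ a + t * (6 * m)
    reorder = solve-∀
  ≡±Exceptional⇒∣p3′ n (a , exceptional , inj₂ (t , n+a≡t6m))
    with _ , b , a+b≡6m , m∣p3′b ← exceptional-partner exceptional =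
    Equivalence.to (∣p3′-periodic m 1 n)
      (subst (λ x → m ∣ p3′ x) t6m+b≡6m+n (Equivalence.from (∣p3′-periodic m t b) m∣p3′b))
    where
    open ≡-Reasoning
    reassociate : ∀ t m → t * m * 6 ≡ t * (6 * m)
    reassociate = solve-∀
    reorder : ∀ n m → n + 6 * m ≡ 1 * m * 6 + n
    reorder = solve-∀
    t6m+b≡6m+n : t * m * 6 + b ≡ 1 * m * 6 + n
    t6m+b≡6m+n = begin
      t * m * 6 + b   ≡⟨ cong (_+ b) (trans (reassociate t m) (sym n+a≡t6m)) ⟩
      n + a + b       ≡⟨ +-assoc n a b ⟩
      n + (a + b)     ≡⟨ cong (λ z → n + z) a+b≡6m ⟩
      n + 6 * m       ≡⟨ reorder n m ⟩
      1 * m * 6 + n   ∎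

  ∣p3′⇔≡±Exceptional : ∀ n → m ∣ p3′ n ⇔ ≡±Exceptional m n
  ∣p3′⇔≡±Exceptional n = mk⇔ ∣p3′⇒≡±Exceptional (≡±Exceptional⇒∣p3′ n)
    where
    n≡q*6+r : n ≡ n / 6 * 6 + n % 6
    n≡q*6+r = trans (m≡m%n+[m/n]*n n 6) (+-comm (n % 6) (n / 6 * 6))
    ∣p3′⇒≡±Exceptional : m ∣ p3′ n → ≡±Exceptional m n
    ∣p3′⇒≡±Exceptional m∣p = subst (≡±Exceptional m) (sym n≡q*6+r)
      (∣p3′[6q+r]⇒≡±Exceptional (n / 6) (n % 6) (m%n<n n 6)
        (subst (λ x → m ∣ p3′ x) n≡q*6+r m∣p))

  exceptional<6m : ∀ {a} → Exceptional m a → a < 6 * m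
  exceptional<6m exceptional = ≤-<-trans (exceptional≤2m+1 exceptional) 2m+1<6m
    where
    exceptional≤2m+1 : ∀ {a} → Exceptional m a → a ≤ 2 * m + 1
    exceptional≤2m+1 (inj₁ refl)                      = z≤n
    exceptional≤2m+1 (inj₂ (inj₁ refl))               = s≤s z≤n
    exceptional≤2m+1 (inj₂ (inj₂ (inj₁ refl)))        = s≤s (s≤s z≤n)
    exceptional≤2m+1 (inj₂ (inj₂ (inj₂ (inj₁ refl)))) = ≤-trans (m∸n≤m (2 * m) 2) (m≤m+n (2 * m) 1)
    exceptional≤2m+1 (inj₂ (inj₂ (inj₂ (inj₂ refl)))) = ≤-refl
    split : ∀ i → 6 * (5 + 6 * i) ≡ 2 * (5 + 6 * i) + 1 + (19 + 24 * i)
    split = solve-∀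
    2m+1<6m : 2 * m + 1 < 6 * m
    2m+1<6m = subst (2 * m + 1 <_) (sym (split i)) (m<m+n (2 * m + 1) (s≤s z≤n))

  ∣p3-characterisation : ∀ n → (m ∣ p3 n) ⇔
    (∃[ ε ] ∃[ a ] ((ε ≡ + 1 ⊎ ε ≡ - (+ 1)) × Exceptional m a ×
      ((+ (6 * m)) ∣ℤ ((+ n) -ℤ (ε *ℤ (+ a))))))
  ∣p3-characterisation n rewrite p3≡p3′ n =
    ⇔.trans (∣p3′⇔≡±Exceptional n) (≡±⇔∣ℤ (Exceptional m) exceptional<6m)

6[1+i]∸1≡5+6i : ∀ i → 6 * suc i ∸ 1 ≡ 5 + 6 * i
6[1+i]∸1≡5+6i i = cong (_∸ 1) (identity i)
  where
  identity : ∀ i → 6 * suc i ≡ 1 + (5 + 6 * i)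
  identity = solve-∀

proposition1 : (j m : ℕ) → 1 ≤ j → m ≡ 6 * j ∸ 1 → Prime m →
    (n : ℕ) →
      (m ∣ p3 n) ⇔
      (∃[ ε ] ∃[ a ] ((ε ≡ + 1 ⊎ ε ≡ - (+ 1)) ×
        (a ≡ 0 ⊎ a ≡ 1 ⊎ a ≡ 2 ⊎ a ≡ 2 * m ∸ 2 ⊎ a ≡ 2 * m + 1) ×
        ((+ (6 * m)) ∣ℤ ((+ n) -ℤ (ε *ℤ (+ a))))))
proposition1 (suc i) m _ m≡6j∸1 m-prime n with trans m≡6j∸1 (6[1+i]∸1≡5+6i i)
... | refl = Residues.∣p3-characterisation {i} m-prime n
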